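{- If $G$ is a connected graph of order $n\geq 3$ whose set of stems is a total dominating set of $G$, then $D_{\gamma_t(G)}^t(G)$ is connected.
   Context: A total dominating set (TDS) of a graph $G$ without isolated vertices is a set $S\subseteq V(G)$ such that every vertex of $G$ is adjacent to a vertex of $S$; $\gamma_t(G)$ is the minimum cardinality of a TDS. A leaf is a vertex of degree $1$ and a stem is a vertex adjacent to a leaf. For a positive integer $k$, $D_k^t(G)$ is the graph whose vertices are the TDSs of $G$ of cardinality at most $k$, two being adjacent if and only if one is obtained from the other by adding or deleting a single vertex. -}

module Defs where

open import Level using (0ℓ)
open import Data.Nat using (ℕ; _≤_)
open import Data.Fin using (Fin)
open import Data.Fin.Subset using (Subset; _∈_; _∉_; _∪_; ⁅_⁆; ∣_∣)
open import Data.Product using (Σ; ∃; ∃-syntax; _×_)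
open import Data.Sum using (_⊎_)
open import Data.Unit using (⊤)
open import Relation.Nullary using (¬_)
open import Relation.Binary.PropositionalEquality using (_≡_)

record Graph (n : ℕ) : Set₁ where
  field
    Adj    : Fin n → Fin n → Set
    sym    : ∀ {u v} → Adj u v → Adj v u
    irrefl : ∀ {v} → ¬ Adj v v
open Graph public

data Walk {A : Set} (V : A → Set) (E : A → A → Set) : A → A → Set where
  here : ∀ {x} → V x → Walk V E x x
  step : ∀ {x y z} → V x → E x y → Walk V E y z → Walk V E x z

ConnectedOn : {A : Set} → (A → Set) → (A → A → Set) → Set
ConnectedOn {A} V E = ∀ (x y : A) → V x → V y → Walk V E x y

AllTrue : {A : Set} → A → Set
AllTrue _ = ⊤

Connected : ∀ {n} → Graph n → Set
Connected {n} G = ConnectedOn {Fin n} AllTrue (Adj G)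

TotallyDominates : ∀ {n} → Graph n → (Fin n → Set) → Set
TotallyDominates {n} G P = ∀ (v : Fin n) → ∃[ u ] (P u × Adj G v u)

IsTDS : ∀ {n} → Graph n → Subset n → Set
IsTDS G S = TotallyDominates G (λ u → u ∈ S)

IsTotalDomNumber : ∀ {n} → Graph n → ℕ → Set
IsTotalDomNumber G k =
  (∃[ S ] (IsTDS G S × ∣ S ∣ ≡ k)) × (∀ S → IsTDS G S → k ≤ ∣ S ∣)

IsLeaf : ∀ {n} → Graph n → Fin n → Set
IsLeaf G v = ∃[ u ] (Adj G v u × (∀ w → Adj G v w → w ≡ u))

IsStem : ∀ {n} → Graph n → Fin n → Set
IsStem G v = ∃[ x ] (IsLeaf G x × Adj G v x)

-- The graph D_k^t(G): vertices are TDSs of cardinality at most k.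
DVertex : ∀ {n} → Graph n → ℕ → Subset n → Set
DVertex G k S = IsTDS G S × ∣ S ∣ ≤ k

AddOne : ∀ {n} → Subset n → Subset n → Set
AddOne S T = ∃[ v ] (v ∉ S × T ≡ S ∪ ⁅ v ⁆)

DAdj : ∀ {n} → Subset n → Subset n → Set
DAdj S T = AddOne S T ⊎ AddOne T S

DConnected : ∀ {n} → Graph n → ℕ → Set
DConnected G k = ConnectedOn (DVertex G k) DAdj

module Submission where

-- A leaf x has exactly one neighbour, its stem v, and any
-- total dominating set must dominate x; hence every TDS contains every
-- stem.  When the stems themselves totally dominate G, it follows that
-- any set containing all stems is a TDS, in particular the intersection
-- S ∩ T of two TDSs.  If S and T have at most γ_t(G) elements, then
-- S ∩ T ⊆ S has at least γ_t(G) ≥ ∣ S ∣ elements, so S ∩ T = S, and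
-- likewise S ∩ T = T.  Thus D^t_{γ_t}(G) has exactly one vertex (the
-- set of stems), and a graph whose vertices all coincide is connected.

open import Defs
open import Data.Nat using (ℕ; _≤_; s≤s)
open import Data.Nat.Properties using (≤-trans; <-irrefl)
open import Data.Fin using (Fin)
open import Data.Fin.Subset using (Subset; _∈_; _⊆_; _∩_; ∣_∣; inside; outside)
open import Data.Fin.Subset.Properties
  using (p⊆q⇒∣p∣≤∣q∣; drop-∷-⊆; p∩q⊆p; p∩q⊆q; x∈p∩q⁺)
open import Data.Vec using (_∷_; []; here)
open import Data.Product using (_,_)
open import Relation.Nullary using (contradiction)
open import Relation.Binary.PropositionalEquality
  using (_≡_; refl; trans; cong; subst)
  renaming (sym to ≡-sym)

⊆-card-eq : ∀ {m} (p q : Subset m) → p ⊆ q → ∣ q ∣ ≤ ∣ p ∣ → p ≡ q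
⊆-card-eq []            []            _   _         = refl
⊆-card-eq (inside ∷ p)  (inside ∷ q)  p⊆q (s≤s ∣q∣≤∣p∣) =
  cong (inside ∷_) (⊆-card-eq p q (drop-∷-⊆ p⊆q) ∣q∣≤∣p∣)
⊆-card-eq (outside ∷ p) (outside ∷ q) p⊆q ∣q∣≤∣p∣ =
  cong (outside ∷_) (⊆-card-eq p q (drop-∷-⊆ p⊆q) ∣q∣≤∣p∣)
⊆-card-eq (inside ∷ p)  (outside ∷ q) p⊆q _       = contradiction (p⊆q here) λ ()
⊆-card-eq (outside ∷ p) (inside ∷ q)  p⊆q ∣q∣<∣p∣ =
  contradiction (≤-trans ∣q∣<∣p∣ (p⊆q⇒∣p∣≤∣q∣ (drop-∷-⊆ p⊆q))) (<-irrefl refl)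

-- Every TDS contains every stem: the leaf attached to a stem v must be
-- dominated, and its only neighbour is v.
stem∈TDS : ∀ {n} (G : Graph n) (S : Subset n) → IsTDS G S →
           ∀ v → IsStem G v → v ∈ S
stem∈TDS G S S-tds v (x , (_ , _ , x-nbrs-unique) , v~x) with S-tds x
... | u , u∈S , x~u =
  subst (_∈ S) (trans (x-nbrs-unique u x~u) (≡-sym (x-nbrs-unique v (sym G v~x)))) u∈S

-- If the stems totally dominate G, then the intersection of two TDSs,
-- which still contains all stems, is again a TDS.
∩-isTDS : ∀ {n} (G : Graph n) → TotallyDominates G (IsStem G) →
          ∀ S T → IsTDS G S → IsTDS G T → IsTDS G (S ∩ T)
∩-isTDS G stems-tds S T S-tds T-tds w with stems-tds w
... | u , u-stem , w~u =
  u , x∈p∩q⁺ (stem∈TDS G S S-tds u u-stem , stem∈TDS G T T-tds u u-stem) , w~u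

-- Under the same hypothesis there is only one TDS of size at most γ_t(G):
-- both S and T coincide with their intersection, by minimality of γ_t(G).
minimumTDS-unique : ∀ {n} (G : Graph n) → TotallyDominates G (IsStem G) →
                    ∀ k → IsTotalDomNumber G k →
                    ∀ S T → DVertex G k S → DVertex G k T → S ≡ T
minimumTDS-unique G stems-tds k (_ , k-minimal) S T (S-tds , ∣S∣≤k) (T-tds , ∣T∣≤k) =
  trans (≡-sym (⊆-card-eq (S ∩ T) S (p∩q⊆p S T) (≤-trans ∣S∣≤k k≤∣S∩T∣)))
        (⊆-card-eq (S ∩ T) T (p∩q⊆q S T) (≤-trans ∣T∣≤k k≤∣S∩T∣))
  where
  k≤∣S∩T∣ : k ≤ ∣ S ∩ T ∣
  k≤∣S∩T∣ = k-minimal (S ∩ T) (∩-isTDS G stems-tds S T S-tds T-tds)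

subsingleton-connected : ∀ {A : Set} (V : A → Set) (E : A → A → Set) →
                         (∀ x y → V x → V y → x ≡ y) → ConnectedOn V E
subsingleton-connected V E all-equal x y Vx Vy =
  subst (Walk V E x) (all-equal x y Vx Vy) (here Vx)

corollary2p4 : ∀ (n : ℕ) (G : Graph n) → 3 ≤ n → Connected G →
               TotallyDominates G (IsStem G) →
               ∀ (k : ℕ) → IsTotalDomNumber G k → DConnected G k
corollary2p4 n G _ _ stems-tds k k-is-γt =
  subsingleton-connected (DVertex G k) DAdj
    (minimumTDS-unique G stems-tds k k-is-γt)
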